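{- If $\mathcal{H}=(V,\mathcal{E})$ is a twin-free hypergraph, then $|V|\leq (TC(\mathcal{H}))^{vc^*(\mathcal{H})}+1$.
   Context: A hypergraph $\mathcal{H}=(V,\mathcal{E})$ is finite. A test cover of $\mathcal{H}$ is a set $\mathcal{C}\subseteq\mathcal{E}$ such that every vertex is in some edge of $\mathcal{C}$ and for any two distinct vertices $x,y$ some edge of $\mathcal{C}$ contains exactly one of $x,y$; $TC(\mathcal{H})$ is the minimum size of a test cover. $\mathcal{H}$ is twin-free if for any two distinct vertices some hyperedge contains exactly one of them. The projection on $X\subseteq V$ is $\mathcal{H}_{|X}=\{e\cap X: e\in\mathcal{E}\}$; $X$ is shattered if $|\mathcal{H}_{|X}|=2^{|X|}$; the VC dimension $vc(\mathcal{H})$ is the maximum size of a shattered set. The dual hypergraph $\mathcal{H}^*$ has the hyperedges of $\mathcal{H}$ as vertices and, for each vertex $v$ of $\mathcal{H}$, a hyperedge consisting of the hyperedges of $\mathcal{H}$ containing $v$. The dual VC dimension is $vc^*(\mathcal{H})=vc(\mathcal{H}^*)$. -}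

module Defs where

open import Data.Nat using (ℕ; _≤_)
open import Data.Fin using (Fin)
open import Data.Fin.Subset using (Subset; _∈_; _∉_; _⊆_; _∩_; ∣_∣)
open import Data.Vec using (tabulate; lookup)
open import Data.Product using (Σ; ∃; _×_)
open import Data.Sum using (_⊎_)
open import Relation.Binary.PropositionalEquality using (_≡_; _≢_)

record Hypergraph : Set where
  field
    n    : ℕ
    m    : ℕ
    edge : Fin m → Subset n
open Hypergraph public

EdgesDistinct : Hypergraph → Set
EdgesDistinct H = ∀ i j → edge H i ≡ edge H j → i ≡ j

Separates : (H : Hypergraph) → Fin (m H) → Fin (n H) → Fin (n H) → Set
Separates H i x y = (x ∈ edge H i × y ∉ edge H i) ⊎ (y ∈ edge H i × x ∉ edge H i)

TwinFree : Hypergraph → Set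
TwinFree H = ∀ x y → x ≢ y → ∃ λ i → Separates H i x y

IsTestCover : (H : Hypergraph) → Subset (m H) → Set
IsTestCover H C =
  (∀ v → ∃ λ i → i ∈ C × v ∈ edge H i) ×
  (∀ x y → x ≢ y → ∃ λ i → i ∈ C × Separates H i x y)

IsTC : Hypergraph → ℕ → Set
IsTC H t =
  (Σ (Subset (m H)) λ C → IsTestCover H C × ∣ C ∣ ≡ t) ×
  (∀ C → IsTestCover H C → t ≤ ∣ C ∣)

Shattered : (H : Hypergraph) → Subset (n H) → Set
Shattered H X = ∀ Y → Y ⊆ X → ∃ λ i → edge H i ∩ X ≡ Y

IsVC : Hypergraph → ℕ → Set
IsVC H d =
  (Σ (Subset (n H)) λ X → Shattered H X × ∣ X ∣ ≡ d) ×
  (∀ X → Shattered H X → ∣ X ∣ ≤ d)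

dual : Hypergraph → Hypergraph
dual H = record
  { n    = m H
  ; m    = n H
  ; edge = λ v → tabulate (λ i → lookup (edge H i) v)
  }

IsDualVC : Hypergraph → ℕ → Set
IsDualVC H d = IsVC (dual H) d

-- Take a test cover C of size t.  Distinct vertices have distinct traces on C
-- (the sets of edges of C containing them), so the traces form a family of at
-- least |V| subsets of C.  A subset of C shattered by the traces is shattered by
-- the dual hypergraph, hence has size at most d, and the Sauer–Shelah lemma bounds
-- the family by Σ_{i ≤ d} (t choose i), which is at most t^d + 1.
module Submission where

open import Defs
open import Data.Nat using (ℕ; zero; suc; _≤_; _<_; _^_; _+_; _*_; z≤n; s≤s)
open import Data.Nat.Properties
open import Algebra.Properties.CommutativeSemigroup +-commutativeSemigroup
  using (interchange; xy∙z≈xz∙y)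
open import Data.Bool using (Bool; true; false; T; _∧_; _∨_; if_then_else_)
import Data.Bool as Bool
open import Data.Bool.Properties using (T-∧; T-∨)
open import Data.Empty using (⊥-elim)
open import Data.Fin using (Fin)
import Data.Fin as Fin
open import Data.Fin.Properties using (any?)
open import Data.Fin.Subset using (Subset; outside; inside; _∈_; _⊆_; _∩_; ⊥; ∣_∣)
open import Data.Fin.Subset.Properties
  using (drop-∷-⊆; out⊆; in⊆in; ⊥⊆; ⊆-antisym; ∩-zeroʳ; ∩-assoc; p∩q⊆q; x∈p∩q⁺; x∈p∩q⁻)
open import Data.List using (List; []; _∷_; length; tabulate)
open import Data.List.Properties using (length-tabulate)
import Data.List.Relation.Unary.All as All
open All using (All; []; _∷_)
import Data.List.Relation.Unary.All.Properties as All
open import Data.List.Relation.Unary.AllPairs using ([]; _∷_)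
open import Data.List.Relation.Unary.Unique.Propositional using (Unique)
import Data.List.Relation.Unary.Unique.Propositional.Properties as Unique
open import Data.Product using (∃; _×_; _,_; proj₁; proj₂)
open import Data.Sum using (inj₁; inj₂; [_,_]′)
open import Data.Vec using ([]; _∷_; here)
open import Data.Vec.Properties using (≡-dec; lookup∘tabulate; []=⇒lookup; lookup⇒[]=)
open import Function using (_∘_)
open import Function.Bundles using (Equivalence)
open import Relation.Nullary using (¬_; Dec; isYes; contradiction)
open import Relation.Nullary.Decidable using (toWitness; fromWitness; decidable-stable)
open import Relation.Binary.PropositionalEquality

private
  variable
    k : ℕ

count : (Subset k → Bool) → ℕ
count {zero}  f = if f [] then 1 else 0
count {suc k} f = count (λ A → f (outside ∷ A)) + count (λ A → f (inside ∷ A))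

count-≤1 : (f : Subset 0 → Bool) → count f ≤ 1
count-≤1 f with f []
... | true  = ≤-refl
... | false = z≤n

count-empty : {f : Subset k → Bool} → (∀ {A} → ¬ T (f A)) → count f ≡ 0
count-empty {zero} {f} ¬f with f [] | ¬f {[]}
... | false | _   = refl
... | true  | ¬f[] = contradiction _ ¬f[]
count-empty {suc k} {f} ¬f =
  cong₂ _+_ (count-empty {f = λ A → f (outside ∷ A)} ¬f)
            (count-empty {f = λ A → f (inside ∷ A)} ¬f)

count-∨-∧ : (f g : Subset k → Bool) →
  count f + count g ≡ count (λ A → f A ∨ g A) + count (λ A → f A ∧ g A)
count-∨-∧ {zero} f g with f [] | g []
... | false | false = refl
... | false | true  = refl
... | true  | false = refl
... | true  | true  = refl
count-∨-∧ {suc k} f g =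
  trans (interchange (count f₀) (count f₁) (count g₀) (count g₁))
    (trans (cong₂ _+_ (count-∨-∧ f₀ g₀) (count-∨-∧ f₁ g₁))
      (interchange (count (f₀ ∨ᶠ g₀)) (count (f₀ ∧ᶠ g₀)) (count (f₁ ∨ᶠ g₁)) (count (f₁ ∧ᶠ g₁))))
  where
  _∨ᶠ_ _∧ᶠ_ : (Subset k → Bool) → (Subset k → Bool) → Subset k → Bool
  (p ∨ᶠ q) A = p A ∨ q A
  (p ∧ᶠ q) A = p A ∧ q A
  f₀ f₁ g₀ g₁ : Subset k → Bool
  f₀ A = f (outside ∷ A)
  f₁ A = f (inside ∷ A)
  g₀ A = g (outside ∷ A)
  g₁ A = g (inside ∷ A)

tailsWithHead : Bool → List (Subset (suc k)) → List (Subset k)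
tailsWithHead b       []                   = []
tailsWithHead outside ((outside ∷ A) ∷ As) = A ∷ tailsWithHead outside As
tailsWithHead inside  ((inside ∷ A) ∷ As)  = A ∷ tailsWithHead inside As
tailsWithHead b       ((_ ∷ A) ∷ As)       = tailsWithHead b As

length-tailsWithHead : (As : List (Subset (suc k))) →
  length As ≡ length (tailsWithHead outside As) + length (tailsWithHead inside As)
length-tailsWithHead []                   = refl
length-tailsWithHead ((outside ∷ A) ∷ As) = cong suc (length-tailsWithHead As)
length-tailsWithHead ((inside ∷ A) ∷ As)  =
  trans (cong suc (length-tailsWithHead As)) (sym (+-suc _ _))

tailsWithHead-all : ∀ {p} {P : Subset (suc k) → Set p} b {As} →
  All P As → All (λ A → P (b ∷ A)) (tailsWithHead b As)
tailsWithHead-all b       {[]}                  []       = []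
tailsWithHead-all outside {(outside ∷ A) ∷ As} (PA ∷ ps) = PA ∷ tailsWithHead-all outside ps
tailsWithHead-all inside  {(inside ∷ A) ∷ As}  (PA ∷ ps) = PA ∷ tailsWithHead-all inside ps
tailsWithHead-all outside {(inside ∷ A) ∷ As}  (_ ∷ ps)  = tailsWithHead-all outside ps
tailsWithHead-all inside  {(outside ∷ A) ∷ As} (_ ∷ ps)  = tailsWithHead-all inside ps

tailsWithHead-unique : ∀ b {As : List (Subset (suc k))} →
  Unique As → Unique (tailsWithHead b As)
tailsWithHead-unique b       {[]}                  []        = []
tailsWithHead-unique outside {(outside ∷ A) ∷ As} (A∉ ∷ u) =
  All.map (_∘ cong (outside ∷_)) (tailsWithHead-all outside A∉) ∷ tailsWithHead-unique outside u
tailsWithHead-unique inside  {(inside ∷ A) ∷ As}  (A∉ ∷ u) =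
  All.map (_∘ cong (inside ∷_)) (tailsWithHead-all inside A∉) ∷ tailsWithHead-unique inside u
tailsWithHead-unique outside {(inside ∷ A) ∷ As}  (_ ∷ u)   = tailsWithHead-unique outside u
tailsWithHead-unique inside  {(outside ∷ A) ∷ As} (_ ∷ u)   = tailsWithHead-unique inside u

length≤count : (f : Subset k → Bool) {As : List (Subset k)} →
  Unique As → All (T ∘ f) As → length As ≤ count f
length≤count {zero} f {[]}          _                 _          = z≤n
length≤count {zero} f {[] ∷ []}     _                 (f[] ∷ []) with f []
... | true  = ≤-refl
... | false = ⊥-elim f[]
length≤count {zero} f {[] ∷ [] ∷ _} ((≢[] ∷ _) ∷ _) _          = contradiction refl ≢[]
length≤count {suc k} f {As} u fAs = begin
  length As                                                           ≡⟨ length-tailsWithHead As ⟩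
  length (tailsWithHead outside As) + length (tailsWithHead inside As) ≤⟨ +-mono-≤
    (length≤count _ (tailsWithHead-unique outside u) (tailsWithHead-all outside fAs))
    (length≤count _ (tailsWithHead-unique inside u) (tailsWithHead-all inside fAs)) ⟩
  count f                                                             ∎
  where open ≤-Reasoning

injection⇒≤count : ∀ {n} (f : Subset k → Bool) (g : Fin n → Subset k) →
  (∀ {i j} → g i ≡ g j → i ≡ j) → (∀ i → T (f (g i))) → n ≤ count f
injection⇒≤count f g g-injective fg =
  subst (_≤ count f) (length-tabulate g)
    (length≤count f (Unique.tabulate⁺ g-injective) (All.tabulate⁺ fg))

Shatters : (Subset k → Bool) → Subset k → Set
Shatters f X = ∀ Y → Y ⊆ X → ∃ λ A → T (f A) × A ∩ X ≡ Y

someExtension bothExtensions : (Subset (suc k) → Bool) → Subset k → Bool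
someExtension  f A = f (outside ∷ A) ∨ f (inside ∷ A)
bothExtensions f A = f (outside ∷ A) ∧ f (inside ∷ A)

count-∷ : (f : Subset (suc k) → Bool) →
  count f ≡ count (someExtension f) + count (bothExtensions f)
count-∷ f = count-∨-∧ (λ A → f (outside ∷ A)) (λ A → f (inside ∷ A))

shatters-⊥ : {f : Subset k → Bool} {A : Subset k} → T (f A) → Shatters f ⊥
shatters-⊥ {A = A} fA Y Y⊆⊥ = A , fA , trans (∩-zeroʳ A) (⊆-antisym ⊥⊆ Y⊆⊥)

someExtension-shatters : {f : Subset (suc k) → Bool} {X : Subset k} →
  Shatters (someExtension f) X → Shatters f (outside ∷ X)
someExtension-shatters sh (inside ∷ Y) Y⊆ with Y⊆ here
... | ()
someExtension-shatters {f = f} sh (outside ∷ Y) Y⊆ with sh Y (drop-∷-⊆ Y⊆)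
... | A , fA , A∩X≡Y with Equivalence.to (T-∨ {f (outside ∷ A)}) fA
...   | inj₁ f₀A = outside ∷ A , f₀A , cong (outside ∷_) A∩X≡Y
...   | inj₂ f₁A = inside ∷ A , f₁A , cong (outside ∷_) A∩X≡Y

bothExtensions-shatters : {f : Subset (suc k) → Bool} {X : Subset k} →
  Shatters (bothExtensions f) X → Shatters f (inside ∷ X)
bothExtensions-shatters {f = f} sh (outside ∷ Y) Y⊆ with sh Y (drop-∷-⊆ Y⊆)
... | A , fA , A∩X≡Y =
  outside ∷ A , proj₁ (Equivalence.to (T-∧ {f (outside ∷ A)}) fA) , cong (outside ∷_) A∩X≡Y
bothExtensions-shatters {f = f} sh (inside ∷ Y) Y⊆ with sh Y (drop-∷-⊆ Y⊆)
... | A , fA , A∩X≡Y =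
  inside ∷ A , proj₂ (Equivalence.to (T-∧ {f (outside ∷ A)}) fA) , cong (inside ∷_) A∩X≡Y

someExtension-within : {f : Subset (suc k) → Bool} {b : Bool} {G : Subset k} →
  (∀ {A} → T (f A) → A ⊆ b ∷ G) → ∀ {A} → T (someExtension f A) → A ⊆ G
someExtension-within {f = f} within {A} fA =
  [ drop-∷-⊆ ∘ within , drop-∷-⊆ ∘ within ]′ (Equivalence.to (T-∨ {f (outside ∷ A)}) fA)

bothExtensions-within : {f : Subset (suc k) → Bool} {b : Bool} {G : Subset k} →
  (∀ {A} → T (f A) → A ⊆ b ∷ G) → ∀ {A} → T (bothExtensions f A) → A ⊆ G
bothExtensions-within {f = f} within {A} fA =
  drop-∷-⊆ (within (proj₁ (Equivalence.to (T-∧ {f (outside ∷ A)}) fA)))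

-- sauerBound t e = Σ_{i < e} (t choose i), computed by Pascal's rule.
sauerBound : ℕ → ℕ → ℕ
sauerBound t       zero    = 0
sauerBound zero    (suc e) = 1
sauerBound (suc t) (suc e) = sauerBound t (suc e) + sauerBound t e

sauer-shelah : (G : Subset k) (e : ℕ) (f : Subset k → Bool) →
  (∀ {A} → T (f A) → A ⊆ G) →
  (∀ X → X ⊆ G → Shatters f X → ∣ X ∣ < e) →
  count f ≤ sauerBound ∣ G ∣ e
sauer-shelah G zero f _ small =
  ≤-reflexive (count-empty {f = f} λ fA → n≮0 (small ⊥ ⊥⊆ (shatters-⊥ fA)))
sauer-shelah [] (suc e) f _ _ = count-≤1 f
sauer-shelah (outside ∷ G) (suc e) f within small = begin
  count f                                            ≡⟨ count-∷ f ⟩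
  count (someExtension f) + count (bothExtensions f) ≡⟨ cong (count (someExtension f) +_)
                                                          (count-empty {f = bothExtensions f} noneInBoth) ⟩
  count (someExtension f) + 0                        ≡⟨ +-identityʳ _ ⟩
  count (someExtension f)                            ≤⟨ sauer-shelah G (suc e) _
    (someExtension-within within)
    (λ X X⊆G sh → small (outside ∷ X) (out⊆ X⊆G) (someExtension-shatters sh)) ⟩
  sauerBound ∣ G ∣ (suc e)                           ∎
  where
  open ≤-Reasoning
  noneInBoth : ∀ {A} → ¬ T (bothExtensions f A)
  noneInBoth {A} fA with within (proj₂ (Equivalence.to (T-∧ {f (outside ∷ A)}) fA)) here
  ... | ()
sauer-shelah (inside ∷ G) (suc e) f within small = begin
  count f                                            ≡⟨ count-∷ f ⟩
  count (someExtension f) + count (bothExtensions f) ≤⟨ +-mono-≤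
    (sauer-shelah G (suc e) _ (someExtension-within within)
      (λ X X⊆G sh → small (outside ∷ X) (out⊆ X⊆G) (someExtension-shatters sh)))
    (sauer-shelah G e _ (bothExtensions-within within)
      (λ X X⊆G sh → ≤-pred (small (inside ∷ X) (in⊆in X⊆G) (bothExtensions-shatters sh)))) ⟩
  sauerBound (∣ G ∣) (suc e) + sauerBound (∣ G ∣) e  ∎
  where open ≤-Reasoning

sauerBound≤suc^ : ∀ t d → sauerBound t (suc d) ≤ suc t ^ d
sauerBound≤suc^ zero    d    = ≤-reflexive (sym (^-zeroˡ d))
sauerBound≤suc^ (suc t) zero =
  subst (_≤ 1) (sym (+-identityʳ (sauerBound t 1))) (sauerBound≤suc^ t zero)
sauerBound≤suc^ (suc t) (suc d) = begin
  sauerBound t (suc (suc d)) + sauerBound t (suc d) ≤⟨ +-mono-≤ (sauerBound≤suc^ t (suc d))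
                                                                (sauerBound≤suc^ t d) ⟩
  suc t ^ suc d + suc t ^ d                         ≡⟨ +-comm (suc t ^ suc d) _ ⟩
  suc t ^ d + suc t * suc t ^ d                     ≤⟨ +-mono-≤ (^-monoˡ-≤ d (n≤1+n _))
                                                                (*-monoʳ-≤ (suc t) (^-monoˡ-≤ d (n≤1+n _))) ⟩
  suc (suc t) ^ suc d                               ∎
  where open ≤-Reasoning

sauerBound≤^+1 : ∀ t d → sauerBound t (suc d) ≤ t ^ d + 1
sauerBound≤^+1 zero    d       = m≤n+m 1 (0 ^ d)
sauerBound≤^+1 (suc t) zero    = m≤n⇒m≤1+n (sauerBound≤suc^ (suc t) zero)
sauerBound≤^+1 (suc t) (suc d) = begin
  sauerBound t (suc (suc d)) + sauerBound t (suc d) ≤⟨ +-mono-≤ (sauerBound≤^+1 t (suc d))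
                                                                (sauerBound≤suc^ t d) ⟩
  (t ^ suc d + 1) + suc t ^ d                       ≡⟨ xy∙z≈xz∙y (t ^ suc d) 1 _ ⟩
  (t * t ^ d + suc t ^ d) + 1                       ≤⟨ +-monoˡ-≤ 1 (+-monoˡ-≤ _
                                                         (*-monoʳ-≤ t (^-monoˡ-≤ d (n≤1+n t)))) ⟩
  (t * suc t ^ d + suc t ^ d) + 1                   ≡⟨ cong (_+ 1) (+-comm (t * suc t ^ d) _) ⟩
  suc t ^ suc d + 1                                 ∎
  where open ≤-Reasoning

p⊆q⇒q∩p≡p : ∀ {p q : Subset k} → p ⊆ q → q ∩ p ≡ p
p⊆q⇒q∩p≡p {p = p} {q} p⊆q = ⊆-antisym (p∩q⊆q q p) (λ x∈p → x∈p∩q⁺ (p⊆q x∈p , x∈p))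

module _ (H : Hypergraph) where

  ∈dual⁺ : ∀ {v i} → v ∈ edge H i → i ∈ edge (dual H) v
  ∈dual⁺ {v} {i} v∈eᵢ =
    lookup⇒[]= i (edge (dual H) v) (trans (lookup∘tabulate _ i) ([]=⇒lookup v∈eᵢ))

  ∈dual⁻ : ∀ {v i} → i ∈ edge (dual H) v → v ∈ edge H i
  ∈dual⁻ {v} {i} i∈e*ᵥ =
    lookup⇒[]= v (edge H i) (trans (sym (lookup∘tabulate _ i)) ([]=⇒lookup i∈e*ᵥ))

  module _ (C : Subset (m H)) where

    trace : Fin (n H) → Subset (m H)
    trace v = edge (dual H) v ∩ C

    ∈trace⁺ : ∀ {v i} → v ∈ edge H i → i ∈ C → i ∈ trace v
    ∈trace⁺ v∈eᵢ i∈C = x∈p∩q⁺ (∈dual⁺ v∈eᵢ , i∈C)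

    ∈trace⁻ : ∀ {v i} → i ∈ trace v → v ∈ edge H i
    ∈trace⁻ i∈trace = ∈dual⁻ (proj₁ (x∈p∩q⁻ _ C i∈trace))

    separates⇒trace≢ : ∀ {i x y} → i ∈ C → Separates H i x y → trace x ≢ trace y
    separates⇒trace≢ i∈C (inj₁ (x∈eᵢ , y∉eᵢ)) tx≡ty =
      y∉eᵢ (∈trace⁻ (subst (_ ∈_) tx≡ty (∈trace⁺ x∈eᵢ i∈C)))
    separates⇒trace≢ i∈C (inj₂ (y∈eᵢ , x∉eᵢ)) tx≡ty =
      x∉eᵢ (∈trace⁻ (subst (_ ∈_) (sym tx≡ty) (∈trace⁺ y∈eᵢ i∈C)))

    trace-injective : (∀ x y → x ≢ y → ∃ λ i → i ∈ C × Separates H i x y) →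
      ∀ {x y} → trace x ≡ trace y → x ≡ y
    trace-injective separating {x} {y} tx≡ty = decidable-stable (x Fin.≟ y) λ x≢y →
      let (i , i∈C , i-separates) = separating x y x≢y
      in separates⇒trace≢ i∈C i-separates tx≡ty

    trace? : ∀ A → Dec (∃ λ v → trace v ≡ A)
    trace? A = any? λ v → ≡-dec Bool._≟_ (trace v) A

    traces : Subset (m H) → Bool
    traces A = isYes (trace? A)

    trace∈traces : ∀ v → T (traces (trace v))
    trace∈traces v = fromWitness (v , refl)

    traces-within : ∀ {A} → T (traces A) → A ⊆ C
    traces-within tA with toWitness tA
    ... | v , refl = p∩q⊆q _ C

    traces-shatter⇒dual-shatters : ∀ {X} → X ⊆ C → Shatters traces X → Shattered (dual H) X
    traces-shatter⇒dual-shatters {X} X⊆C shatters Y Y⊆X with shatters Y Y⊆X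
    ... | A , tA , A∩X≡Y with toWitness tA
    ...   | v , refl = v , (begin
      edge (dual H) v ∩ X       ≡⟨ cong (edge (dual H) v ∩_) (p⊆q⇒q∩p≡p X⊆C) ⟨
      edge (dual H) v ∩ (C ∩ X) ≡⟨ ∩-assoc (edge (dual H) v) C X ⟨
      trace v ∩ X               ≡⟨ A∩X≡Y ⟩
      Y                         ∎)
      where open ≡-Reasoning

proposition1 : (H : Hypergraph) → EdgesDistinct H → TwinFree H →
    (t d : ℕ) → IsTC H t → IsDualVC H d →
    n H ≤ t ^ d + 1
proposition1 H _ _ t d ((C , (_ , separating) , ∣C∣≡t) , _) (_ , vc*≤d) = begin
  n H                        ≤⟨ injection⇒≤count (traces H C) (trace H C)
                                  (trace-injective H C separating) (trace∈traces H C) ⟩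
  count (traces H C)         ≤⟨ sauer-shelah C (suc d) (traces H C) (traces-within H C)
                                  (λ X X⊆C sh → s≤s (vc*≤d X (traces-shatter⇒dual-shatters H C X⊆C sh))) ⟩
  sauerBound (∣ C ∣) (suc d) ≡⟨ cong (λ c → sauerBound c (suc d)) ∣C∣≡t ⟩
  sauerBound t (suc d)       ≤⟨ sauerBound≤^+1 t d ⟩
  t ^ d + 1                  ∎
  where open ≤-Reasoning
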